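{- Let $k\ge 2$, let $A$ be a $k$-primitive set, and let $T\subset A$ with $|\mathcal{P}(T)| = n$. If $n\le k$, then $|T|\le n$. If $n=k+1$, then $|T|\le n+1$. Further, if $k=2$ and $n=4$, then $|T|\le 19$.
   Context: For an integer $k\ge 1$, a set $A$ of integers greater than $1$ with $|A|\ge k+1$ is called $k$-primitive if no element of $A$ divides the product of $k$ distinct other elements of $A$. For a set $T$ of positive integers, $\mathcal{P}(T)$ denotes the set of primes dividing some member of $T$. -}

module Defs where

open import Data.Nat using (ℕ; _<_; _≤_; _+_)
open import Data.Nat.Divisibility using (_∣_)
open import Data.Nat.Primality using (Prime)
open import Data.List using (List; length)
open import Data.Nat.ListAction using (product)
open import Data.List.Membership.Propositional using (_∈_; _∉_)
open import Data.List.Relation.Unary.All using (All)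
open import Data.List.Relation.Unary.Unique.Propositional using (Unique)
open import Data.Product using (Σ; ∃; _×_)
open import Function.Bundles using (_⇔_)
open import Relation.Binary.PropositionalEquality using (_≡_)
open import Relation.Nullary using (¬_)

NatSet : Set₁
NatSet = ℕ → Set

_⊆_ : NatSet → NatSet → Set
S ⊆ T = ∀ x → S x → T x

HasCard : NatSet → ℕ → Set
HasCard S n = Σ (List ℕ) λ xs → Unique xs × length xs ≡ n × (∀ x → x ∈ xs ⇔ S x)

CardLe : NatSet → ℕ → Set
CardLe S n = ∀ (xs : List ℕ) → Unique xs → All S xs → length xs ≤ n

CardGe : NatSet → ℕ → Set
CardGe S m = Σ (List ℕ) λ xs → Unique xs × length xs ≡ m × All S xs

KPrimitive : ℕ → NatSet → Set
KPrimitive k A =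
  (∀ a → A a → 1 < a) ×
  CardGe A (k + 1) ×
  (∀ a (bs : List ℕ) → A a → Unique bs → length bs ≡ k → All A bs → a ∉ bs →
     ¬ (a ∣ product bs))

PrimesOf : NatSet → NatSet
PrimesOf T p = Prime p × ∃ λ t → T t × p ∣ t

module Submission where

-- With a ≼[ p ] c meaning v_p(a) ≤ v_p(c), the key consequence of k-primitivity is
-- 'uncoverable': no a ∈ A is p-dominated, at every prime p of a, by one of at most k
-- other members of A, since padding them to k distinct members (A has k + 1 elements)
-- would make a divide their product ('prime-powers-∣').  In a finite part of T pick,
-- for each of the n primes p, a member of maximal p-part (its champion).
--   n ≤ k:        a member outside the champions is covered by them;
--   n = k + 1:    two members outside them dominate each other at one prime at most
--                 (else one and k - 1 champions cover the other): impossible at 3 primes;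
--   k = 2, n = 4: the profile of a member (for which sets of exempted primes among
--                 p₁, p₂, p₃ another member dominates it at the rest) is monotone, false
--                 without exemptions, and separates members; only 19 such functions exist.

open import Defs
open import Data.Bool using (Bool; true; false; not; f≤t; b≤b) renaming (_≤_ to _≤ᵇ_; _≟_ to _≟ᵇ_)
open import Data.Bool.Properties using () renaming (_≤?_ to _≤ᵇ?_)
open import Data.Empty using (⊥; ⊥-elim)
open import Data.List using (List; []; _∷_; _++_; length; map; filter; cartesianProduct; deduplicate)
open import Data.List.Properties using (length-map; length-deduplicate)
open import Data.List.Membership.Propositional using (_∈_; _∉_; find; lose)
open import Data.List.Membership.Propositional.Properties
  using (∈-∃++; ∈-map⁺; ∈-map⁻; ∈-filter⁺; ∈-cartesianProduct⁺; ∈-deduplicate⁺; ∈-deduplicate⁻)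
open import Data.List.Relation.Unary.All using (All; []; _∷_)
import Data.List.Relation.Unary.All as All
import Data.List.Relation.Unary.All.Properties as All
open import Data.List.Relation.Unary.AllPairs using ([]; _∷_)
open import Data.List.Relation.Unary.Any using (Any; here; there; any?)
import Data.List.Relation.Unary.Any as Any
open import Data.List.Relation.Unary.Unique.Propositional using (Unique)
open import Data.List.Relation.Binary.Permutation.Propositional using (_↭_; prep; ↭-sym; ↭-trans)
open import Data.List.Relation.Binary.Permutation.Propositional.Properties using (shift; ∈-resp-↭; ↭-length)
open import Data.Nat using (ℕ; zero; suc; _+_; _*_; _∸_; _^_; _≤_; _<_; s≤s; z≤n; NonZero; >-nonZero; nonTrivial⇒n>1)
open import Data.Nat.Properties
open import Data.List.Relation.Unary.Unique.DecPropositional.Properties _≟_ using (deduplicate-!)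
open import Data.Nat.Divisibility
open import Data.Nat.Coprimality using (Coprime; coprime-divisor)
open import Data.Nat.Primality
open import Data.Nat.Primality.Factorisation using (factorise; PrimeFactorisation)
open import Data.Nat.ListAction using (product)
open import Data.Nat.ListAction.Properties using (∈⇒∣product)
open import Data.Product using (_,_; ∃; _×_; proj₁; proj₂)
open import Data.Sum using (_⊎_; inj₁; inj₂)
open import Data.Unit using (⊤; tt)
open import Function using (_∘_; case_of_)
open import Function.Bundles using (_⇔_; Equivalence)
open import Relation.Binary.Definitions using (DecidableEquality)
open import Relation.Binary.PropositionalEquality
open import Relation.Nullary using (¬_; Dec; yes; no; does; contradiction; map′)
open import Relation.Nullary.Decidable using (_×-dec_; _→-dec_; ¬?; decidable-stable; dec-true; dec-false)

module _ {X : Set} where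

  ∈⇒↭ : ∀ {x : X} {xs} → x ∈ xs → ∃ λ ys → xs ↭ x ∷ ys
  ∈⇒↭ x∈xs with ys , zs , refl ← ∈-∃++ x∈xs = ys ++ zs , shift _ ys zs

  ∈⇒↭₂ : ∀ {x y : X} {xs} → x ∈ xs → y ∈ xs → x ≢ y → ∃ λ zs → xs ↭ x ∷ y ∷ zs
  ∈⇒↭₂ {x} {y} x∈xs y∈xs x≢y with ys , xs↭ ← ∈⇒↭ x∈xs with ∈-resp-↭ xs↭ y∈xs
  ... | here y≡x = contradiction (sym y≡x) x≢y
  ... | there y∈ys with zs , ys↭ ← ∈⇒↭ y∈ys = zs , ↭-trans xs↭ (prep x ys↭)

  unique-⊆⇒length≤ : ∀ {xs ys : List X} → Unique xs → (∀ {z} → z ∈ xs → z ∈ ys) → length xs ≤ length ys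
  unique-⊆⇒length≤ {[]} _ _ = z≤n
  unique-⊆⇒length≤ {x ∷ xs} {ys} (x∉xs ∷ u) xs⊆ys with ys′ , ys↭ ← ∈⇒↭ (xs⊆ys (here refl)) =
    subst (suc (length xs) ≤_) (sym (↭-length ys↭)) (s≤s (unique-⊆⇒length≤ u xs⊆ys′))
    where
    xs⊆ys′ : ∀ {z} → z ∈ xs → z ∈ ys′
    xs⊆ys′ z∈xs with ∈-resp-↭ ys↭ (xs⊆ys (there z∈xs))
    ... | here z≡x = contradiction (sym z≡x) (All.lookup x∉xs z∈xs)
    ... | there z∈ys′ = z∈ys′

  map-unique : ∀ {Y : Set} {P : X → Set} (f : X → Y) → (∀ {x y} → P x → P y → x ≢ y → f x ≢ f y) →
               ∀ {xs} → All P xs → Unique xs → Unique (map f xs)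
  map-unique f inj [] [] = []
  map-unique f inj (px ∷ pxs) (x∉xs ∷ u) =
    All.map⁺ (All.zipWith (λ (x≢y , py) → inj px py x≢y) (x∉xs , pxs)) ∷ map-unique f inj pxs u

  two-colours : ∀ {R S : X → Set} {xs} → Unique xs → (∀ {x} → x ∈ xs → R x ⊎ S x) →
                (∀ {x y} → x ∈ xs → y ∈ xs → x ≢ y → R x → R y → ⊥) →
                (∀ {x y} → x ∈ xs → y ∈ xs → x ≢ y → S x → S y → ⊥) → length xs ≤ 2
  two-colours {xs = []} _ _ _ _ = z≤n
  two-colours {xs = _ ∷ []} _ _ _ _ = s≤s z≤n
  two-colours {xs = _ ∷ _ ∷ []} _ _ _ _ = s≤s (s≤s z≤n)
  two-colours {xs = x ∷ y ∷ z ∷ _} ((x≢y ∷ x≢z ∷ _) ∷ (y≢z ∷ _) ∷ _) colour R-once S-once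
    with colour (here refl) | colour (there (here refl)) | colour (there (there (here refl)))
  ... | inj₁ Rx | inj₁ Ry | _       = ⊥-elim (R-once (here refl) (there (here refl)) x≢y Rx Ry)
  ... | inj₁ Rx | _       | inj₁ Rz = ⊥-elim (R-once (here refl) (there (there (here refl))) x≢z Rx Rz)
  ... | _       | inj₁ Ry | inj₁ Rz = ⊥-elim (R-once (there (here refl)) (there (there (here refl))) y≢z Ry Rz)
  ... | inj₂ Sx | inj₂ Sy | _       = ⊥-elim (S-once (here refl) (there (here refl)) x≢y Sx Sy)
  ... | inj₂ Sx | _       | inj₂ Sz = ⊥-elim (S-once (here refl) (there (there (here refl))) x≢z Sx Sz)
  ... | _       | inj₂ Sy | inj₂ Sz = ⊥-elim (S-once (there (here refl)) (there (there (here refl))) y≢z Sy Sz)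

  four-members : ∀ (xs : List X) → length xs ≡ 4 →
                 ∃ λ x₁ → ∃ λ x₂ → ∃ λ x₃ → ∃ λ x₄ → xs ≡ x₁ ∷ x₂ ∷ x₃ ∷ x₄ ∷ []
  four-members (x₁ ∷ x₂ ∷ x₃ ∷ x₄ ∷ []) refl = x₁ , x₂ , x₃ , x₄ , refl

  module _ (_≟ₓ_ : DecidableEquality X) where
    open import Data.List.Membership.DecPropositional _≟ₓ_ using (_∈?_)

    longer⇒∉ : ∀ {xs ys : List X} → Unique xs → length ys < length xs → ∃ λ x → x ∈ xs × x ∉ ys
    longer⇒∉ {xs} {ys} u ys<xs with any? (λ x → ¬? (x ∈? ys)) xs
    ... | yes outside = find outside
    ... | no none = contradiction (unique-⊆⇒length≤ u inside) (<⇒≱ ys<xs)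
      where
      inside : ∀ {z} → z ∈ xs → z ∈ ys
      inside {z} z∈xs = decidable-stable (z ∈? ys) (λ z∉ys → none (lose z∈xs z∉ys))

prime>1 : ∀ {p} → Prime p → 1 < p
prime>1 {p} pp = nonTrivial⇒n>1 p {{prime⇒nonTrivial pp}}

-- p-domination, a ≼[ p ] c : every power of p dividing a divides c, i.e. v_p(a) ≤ v_p(c).
_≼[_]_ : ℕ → ℕ → ℕ → Set
a ≼[ p ] c = ∀ e → p ^ e ∣ a → p ^ e ∣ c

≼-refl : ∀ {p a} → a ≼[ p ] a
≼-refl e pᵉ∣a = pᵉ∣a

≼-trans : ∀ {p a b c} → a ≼[ p ] b → b ≼[ p ] c → a ≼[ p ] c
≼-trans a≼b b≼c e pᵉ∣a = b≼c e (a≼b e pᵉ∣a)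

-- Powers of p form a divisibility chain, which makes p-domination total.
^-monoʳ-∣ : ∀ p {e f} → e ≤ f → p ^ e ∣ p ^ f
^-monoʳ-∣ p {f = f} z≤n = 1∣ (p ^ f)
^-monoʳ-∣ p (s≤s e≤f) = *-monoʳ-∣ p (^-monoʳ-∣ p e≤f)

≼-total : ∀ {p a c} → ¬ (a ≼[ p ] c) → c ≼[ p ] a
≼-total {p} {a} {c} a⋠c f pᶠ∣c with p ^ f ∣? a
... | yes pᶠ∣a = pᶠ∣a
... | no pᶠ∤a = contradiction (λ e pᵉ∣a → ∣-trans (^-monoʳ-∣ p (below e pᵉ∣a)) pᶠ∣c) a⋠c
  where
  below : ∀ e → p ^ e ∣ a → e ≤ f
  below e pᵉ∣a with ≤-total e f
  ... | inj₁ e≤f = e≤f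
  ... | inj₂ f≤e = contradiction (∣-trans (^-monoʳ-∣ p f≤e) pᵉ∣a) pᶠ∤a

-- For p > 1, only exponents e with p ^ e ≤ a matter for a ≼[ p ] c.
exponent<power : ∀ {p} → 1 < p → ∀ e → e < p ^ e
exponent<power 1<p zero = s≤s z≤n
exponent<power {p@(suc _)} 1<p (suc e) = begin-strict
  suc e     ≤⟨ exponent<power 1<p e ⟩
  p ^ e     ≡⟨ sym (*-identityˡ (p ^ e)) ⟩
  1 * p ^ e <⟨ *-monoˡ-< (p ^ e) {{m^n≢0 p e}} 1<p ⟩
  p * p ^ e ∎
  where open ≤-Reasoning

-- For p > 1 domination is decidable: for a > 0 only exponents below a matter,
-- and 0 ≼[ p ] c forces every power of p to divide c, i.e. c = 0.
≼-dec : ∀ {p} → 1 < p → ∀ a c → Dec (a ≼[ p ] c)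
≼-dec {p} 1<p zero zero = yes λ e _ → (p ^ e) ∣0
≼-dec {p} 1<p zero c@(suc _) =
  no λ 0≼c → <⇒≱ (exponent<power 1<p c) (∣⇒≤ (0≼c c ((p ^ c) ∣0)))
≼-dec {p} 1<p a@(suc _) c =
  map′ unbounded (λ a≼c {e} _ → a≼c e) (allUpTo? (λ e → p ^ e ∣? a →-dec p ^ e ∣? c) a)
  where
  unbounded : (∀ {e} → e < a → p ^ e ∣ a → p ^ e ∣ c) → a ≼[ p ] c
  unbounded below e pᵉ∣a = below (<-≤-trans (exponent<power 1<p e) (∣⇒≤ pᵉ∣a)) pᵉ∣a

≼-compare : ∀ {p} → 1 < p → ∀ a c → a ≼[ p ] c ⊎ c ≼[ p ] a
≼-compare 1<p a c with ≼-dec 1<p a c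
... | yes a≼c = inj₁ a≼c
... | no a⋠c = inj₂ (≼-total a⋠c)

≼-maximum : ∀ {p} → 1 < p → ∀ x xs → ∃ λ m → m ∈ x ∷ xs × All (_≼[ p ] m) (x ∷ xs)
≼-maximum 1<p x [] = x , here refl , ≼-refl ∷ []
≼-maximum 1<p x (y ∷ ys) with m , m∈ , max ← ≼-maximum 1<p y ys with ≼-compare 1<p x m
... | inj₁ x≼m = m , there m∈ , x≼m ∷ max
... | inj₂ m≼x = x , here refl , ≼-refl ∷ All.map (λ z≼m → ≼-trans z≼m m≼x) max

prime∣prime^⇒≡ : ∀ {p q} → Prime p → Prime q → ∀ e → p ∣ q ^ e → p ≡ q
prime∣prime^⇒≡ pp pq zero p∣1 = contradiction (∣1⇒≡1 p∣1) (>⇒≢ (prime>1 pp))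
prime∣prime^⇒≡ {p} {q} pp pq (suc e) p∣qᵉ⁺¹ with euclidsLemma q (q ^ e) pp p∣qᵉ⁺¹
... | inj₂ p∣qᵉ = prime∣prime^⇒≡ pp pq e p∣qᵉ
... | inj₁ p∣q with prime⇒irreducible pq p∣q
...   | inj₁ p≡1 = contradiction p≡1 (>⇒≢ (prime>1 pp))
...   | inj₂ p≡q = p≡q

prime^-coprime : ∀ {p q} → Prime p → Prime q → q ≢ p → ∀ e → Coprime (q ^ e) p
prime^-coprime pp pq q≢p e (i∣qᵉ , i∣p) with prime⇒irreducible pp i∣p
... | inj₁ i≡1 = i≡1
... | inj₂ refl = contradiction (sym (prime∣prime^⇒≡ pp pq e i∣qᵉ)) q≢p

-- A product of primes divides m once m dominates it at every prime: peel off the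
-- first prime q, which divides m = m′ q, and check that m′ dominates the rest.
primes-product-∣ : ∀ {m} fs → All Prime fs → (∀ p → Prime p → product fs ≼[ p ] m) → product fs ∣ m
primes-product-∣ [] [] _ = 1∣ _
primes-product-∣ (q ∷ fs) (pq ∷ pfs) dom
  with divides-refl m′ ← m*n∣⇒m∣ q 1 (dom q pq 1 (*-monoʳ-∣ q (1∣ product fs))) =
  ∣-trans (*-monoʳ-∣ q (primes-product-∣ fs pfs dom′)) (∣-reflexive (*-comm q m′))
  where
  dom′ : ∀ r → Prime r → product fs ≼[ r ] m′
  dom′ r pr e rᵉ∣fs with r ≟ q
  ... | yes refl = *-cancelˡ-∣ q {{prime⇒nonZero pq}}
                     (∣-trans (dom q pq (suc e) (*-monoʳ-∣ q rᵉ∣fs)) (∣-reflexive (*-comm m′ q)))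
  ... | no r≢q = coprime-divisor (prime^-coprime pq pr r≢q e)
                   (∣-trans (dom r pr e (∣n⇒∣m*n q rᵉ∣fs)) (∣-reflexive (*-comm m′ q)))

prime-powers-∣ : ∀ a {m} .{{_ : NonZero a}} → (∀ p → Prime p → a ≼[ p ] m) → a ∣ m
prime-powers-∣ a {m} dom = subst (_∣ m) (sym a≡∏) (primes-product-∣ factors factorsPrime dom′)
  where
  open PrimeFactorisation (factorise a)
  a≡∏ = isFactorisation
  dom′ : ∀ p → Prime p → product factors ≼[ p ] m
  dom′ p pp e pᵉ∣∏ = dom p pp e (subst (_ ∣_) (sym a≡∏) pᵉ∣∏)

-- Boolean functions of three variables are compared through their value tables,
-- complete binary trees of depth three with Boolean leaves, which can be enumerated.
Fun₃ : Set
Fun₃ = Bool → Bool → Bool → Bool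

Table : Set
Table = ((Bool × Bool) × (Bool × Bool)) × ((Bool × Bool) × (Bool × Bool))

module _ {X : Set} where
  tabulate₂ : (Bool → X) → X × X
  tabulate₂ f = f false , f true

  lookup₂ : X × X → Bool → X
  lookup₂ (x , _) false = x
  lookup₂ (_ , y) true = y

  lookup-tabulate₂ : ∀ f b → lookup₂ (tabulate₂ f) b ≡ f b
  lookup-tabulate₂ f false = refl
  lookup-tabulate₂ f true = refl

  pairs : List X → List (X × X)
  pairs xs = cartesianProduct xs xs

table : Fun₃ → Table
table f = tabulate₂ λ s₁ → tabulate₂ λ s₂ → tabulate₂ (f s₁ s₂)

entry : Table → Fun₃
entry t s₁ s₂ s₃ = lookup₂ (lookup₂ (lookup₂ t s₁) s₂) s₃

entry-table : ∀ f s₁ s₂ s₃ → entry (table f) s₁ s₂ s₃ ≡ f s₁ s₂ s₃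
entry-table f s₁ s₂ s₃ = begin
  lookup₂ (lookup₂ (lookup₂ (table f) s₁) s₂) s₃
    ≡⟨ cong (λ t → lookup₂ (lookup₂ t s₂) s₃)
            (lookup-tabulate₂ (λ s₁ → tabulate₂ λ s₂ → tabulate₂ (f s₁ s₂)) s₁) ⟩
  lookup₂ (lookup₂ (tabulate₂ λ s₂ → tabulate₂ (f s₁ s₂)) s₂) s₃
    ≡⟨ cong (λ t → lookup₂ t s₃) (lookup-tabulate₂ (λ s₂ → tabulate₂ (f s₁ s₂)) s₂) ⟩
  lookup₂ (tabulate₂ (f s₁ s₂)) s₃
    ≡⟨ lookup-tabulate₂ (f s₁ s₂) s₃ ⟩
  f s₁ s₂ s₃ ∎
  where open ≡-Reasoning

tables : List Table
tables = pairs (pairs (pairs (false ∷ true ∷ [])))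

∈-tables : ∀ t → t ∈ tables
∈-tables t = ∈-pairs (∈-pairs (∈-pairs ∈-bools)) t
  where
  ∈-bools : ∀ b → b ∈ false ∷ true ∷ []
  ∈-bools false = here refl
  ∈-bools true = there (here refl)
  ∈-pairs : ∀ {X : Set} {xs : List X} → (∀ x → x ∈ xs) → ∀ p → p ∈ pairs xs
  ∈-pairs all (x , y) = ∈-cartesianProduct⁺ (all x) (all y)

Monotone : Fun₃ → Set
Monotone f = ∀ s₁ s₂ s₃ →
  f false s₂ s₃ ≤ᵇ f true s₂ s₃ × f s₁ false s₃ ≤ᵇ f s₁ true s₃ × f s₁ s₂ false ≤ᵇ f s₁ s₂ true

monotone-resp : ∀ {f g} → (∀ s₁ s₂ s₃ → f s₁ s₂ s₃ ≡ g s₁ s₂ s₃) → Monotone f → Monotone g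
monotone-resp {f} {g} f≗g mono s₁ s₂ s₃ =
  let m₁ , m₂ , m₃ = mono s₁ s₂ s₃ in transport m₁ , transport m₂ , transport m₃
  where
  transport : ∀ {s₁ s₂ s₃ t₁ t₂ t₃} → f s₁ s₂ s₃ ≤ᵇ f t₁ t₂ t₃ → g s₁ s₂ s₃ ≤ᵇ g t₁ t₂ t₃
  transport = subst₂ _≤ᵇ_ (f≗g _ _ _) (f≗g _ _ _)

does-mono : ∀ {P Q : Set} (P? : Dec P) (Q? : Dec Q) → (P → Q) → does P? ≤ᵇ does Q?
does-mono (yes p) (yes _) _ = b≤b
does-mono (yes p) (no ¬q) P→Q = contradiction (P→Q p) ¬q
does-mono (no _) (yes _) _ = f≤t
does-mono (no _) (no _) _ = b≤b

Admissible : Table → Set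
Admissible t = entry t false false false ≡ false × Monotone (entry t)

all-Bool? : ∀ {P : Bool → Set} → (∀ b → Dec (P b)) → Dec (∀ b → P b)
all-Bool? P? = map′ (λ (Pf , Pt) → λ { false → Pf ; true → Pt }) (λ P → P false , P true) (P? false ×-dec P? true)

admissible? : ∀ t → Dec (Admissible t)
admissible? t = (entry t false false false ≟ᵇ false) ×-dec
  all-Bool? λ s₁ → all-Bool? λ s₂ → all-Bool? λ s₃ →
    (g false s₂ s₃ ≤ᵇ? g true s₂ s₃) ×-dec (g s₁ false s₃ ≤ᵇ? g s₁ true s₃) ×-dec
    (g s₁ s₂ false ≤ᵇ? g s₁ s₂ true)
  where g = entry t

admissible-table : ∀ {f} → f false false false ≡ false → Monotone f → Admissible (table f)
admissible-table {f} f⊥ mono =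
  trans (entry-table f _ _ _) f⊥ , monotone-resp (λ s₁ s₂ s₃ → sym (entry-table f s₁ s₂ s₃)) mono

-- There are 20 monotone Boolean functions of three variables (the Dedekind number M(3));
-- all but the constant true vanish at the bottom.
admissible-count : length (filter admissible? tables) ≡ 19
admissible-count = refl

module Primitive {k : ℕ} {A : NatSet} (prim : KPrimitive k A) where

  private
    elements>1 : ∀ a → A a → 1 < a
    elements>1 = proj₁ prim
    W : List ℕ
    W = proj₁ (proj₁ (proj₂ prim))
    W-unique : Unique W
    W-unique = proj₁ (proj₂ (proj₁ (proj₂ prim)))
    W-length : length W ≡ suc k
    W-length = trans (proj₁ (proj₂ (proj₂ (proj₁ (proj₂ prim))))) (+-comm k 1)
    W⊆A : All A W
    W⊆A = proj₂ (proj₂ (proj₂ (proj₁ (proj₂ prim))))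
    nonDividing : ∀ a bs → A a → Unique bs → length bs ≡ k → All A bs → a ∉ bs → ¬ (a ∣ product bs)
    nonDividing = proj₂ (proj₂ prim)

  Covers : List ℕ → ℕ → Set
  Covers L a = ∀ p → Prime p → p ∣ a → Any (a ≼[ p ]_) L

  record Padding (a : ℕ) (L : List ℕ) : Set where
    field
      bs : List ℕ
      unique : Unique bs
      length≡k : length bs ≡ k
      ⊆A : All A bs
      a∉bs : a ∉ bs
      ⊇L : ∀ {x} → x ∈ L → x ∈ bs

  shrink : ∀ {a L L′} → (∀ {x} → x ∈ L′ → x ∈ L) → Padding a L → Padding a L′
  shrink L′⊆L P = record { Padding P hiding (⊇L) ; ⊇L = Padding.⊇L P ∘ L′⊆L }

  fresh : ∀ L → length L ≤ k → ∃ λ w → A w × w ∉ L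
  fresh L L≤k with w , w∈W , w∉L ← longer⇒∉ _≟_ W-unique (≤-<-trans L≤k (subst (k <_) (sym W-length) (n<1+n k)))
    = w , All.lookup W⊆A w∈W , w∉L

  extend : ∀ d {a} L → d + length L ≡ k → Unique L → All A L → a ∉ L → Padding a L
  extend zero L refl uL AL a∉L =
    record { bs = L ; unique = uL ; length≡k = refl ; ⊆A = AL ; a∉bs = a∉L ; ⊇L = λ x∈L → x∈L }
  extend (suc d) {a} L d+L≡k uL AL a∉L
    with w , Aw , w∉a∷L ← fresh (a ∷ L) (subst (suc (length L) ≤_) d+L≡k (s≤s (m≤n+m (length L) d))) =
    shrink there (extend d (w ∷ L) (trans (+-suc d (length L)) d+L≡k) (w∉L ∷ uL) (Aw ∷ AL) a∉w∷L)
    where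
    w∉L : All (w ≢_) L
    w∉L = All.tabulate λ x∈L w≡x → w∉a∷L (there (subst (_∈ L) (sym w≡x) x∈L))
    a∉w∷L : a ∉ w ∷ L
    a∉w∷L (here a≡w) = w∉a∷L (here (sym a≡w))
    a∉w∷L (there a∈L) = a∉L a∈L

  padding : ∀ {a} L → All A L → a ∉ L → length L ≤ k → Padding a L
  padding L AL a∉L L≤k =
    shrink (∈-deduplicate⁺ _≟_)
      (extend (k ∸ length D) D (m∸n+n≡m (≤-trans (length-deduplicate _≟_ L) L≤k)) (deduplicate-! L)
        (All.tabulate (All.lookup AL ∘ ∈-deduplicate⁻ _≟_ L)) (a∉L ∘ ∈-deduplicate⁻ _≟_ L))
    where
    D = deduplicate _≟_ L

  -- The key fact: no member of A is covered by at most k other members of A,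
  -- for then it would divide the product of k distinct other members.
  uncoverable : ∀ {a} L → A a → All A L → a ∉ L → length L ≤ k → ¬ Covers L a
  uncoverable {a} L Aa AL a∉L L≤k covers =
    nonDividing a bs Aa unique length≡k ⊆A a∉bs (prime-powers-∣ a {{a≢0}} a≼∏)
    where
    open Padding (padding L AL a∉L L≤k)
    a≢0 : NonZero a
    a≢0 = >-nonZero (<-trans (s≤s z≤n) (elements>1 a Aa))
    a≼∏ : ∀ p → Prime p → a ≼[ p ] product bs
    a≼∏ p pp zero _ = 1∣ product bs
    a≼∏ p pp (suc e) pᵉ⁺¹∣a with c , c∈L , a≼c ← find (covers p pp (m*n∣⇒m∣ p (p ^ e) pᵉ⁺¹∣a)) =
      ∣-trans (a≼c (suc e) pᵉ⁺¹∣a) (∈⇒∣product (⊇L c∈L))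

  module OverT {T : NatSet} (T⊆A : T ⊆ A) {ps : List ℕ} (ps-primes : ∀ x → x ∈ ps ⇔ PrimesOf T x) where

    ps-prime : ∀ {p} → p ∈ ps → Prime p
    ps-prime {p} p∈ps = proj₁ (Equivalence.to (ps-primes p) p∈ps)

    uncoverable-T : ∀ {a} L → T a → All A L → a ∉ L → length L ≤ k →
                    ¬ (∀ {p} → p ∈ ps → Any (a ≼[ p ]_) L)
    uncoverable-T {a} L Ta AL a∉L L≤k covers =
      uncoverable L (T⊆A a Ta) AL a∉L L≤k
        (λ p pp p∣a → covers (Equivalence.from (ps-primes p) (pp , a , Ta , p∣a)))

    -- Champions in a nonempty list x ∷ xs of members of T: for each prime p a
    -- member of largest p-part (for p ≤ 1, which are not primes, simply x).
    module Champions {x xs} (T-xs : All T (x ∷ xs)) where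

      private
        champion-spec : ∀ p → ∃ λ m → m ∈ x ∷ xs × (1 < p → All (_≼[ p ] m) (x ∷ xs))
        champion-spec p with 1 <? p
        ... | yes 1<p with m , m∈ , max ← ≼-maximum 1<p x xs = m , m∈ , λ _ → max
        ... | no 1≮p = x , here refl , λ 1<p → contradiction 1<p 1≮p

      champion : ℕ → ℕ
      champion p = proj₁ (champion-spec p)

      champion∈ : ∀ p → champion p ∈ x ∷ xs
      champion∈ p = proj₁ (proj₂ (champion-spec p))

      champion-max : ∀ {p} → 1 < p → All (_≼[ p ] champion p) (x ∷ xs)
      champion-max {p} = proj₂ (proj₂ (champion-spec p))

      champions : List ℕ → List ℕ
      champions = map champion

      champions-⊆A : ∀ qs → All A (champions qs)
      champions-⊆A qs = All.tabulate λ c∈ → case ∈-map⁻ champion c∈ of λ where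
        (p , _ , refl) → T⊆A _ (All.lookup T-xs (champion∈ p))

      champions-cover : ∀ {qs p a} → (∀ {q} → q ∈ qs → q ∈ ps) → p ∈ qs → a ∈ x ∷ xs →
                        Any (a ≼[ p ]_) (champions qs)
      champions-cover qs⊆ps p∈qs a∈ =
        lose (∈-map⁺ champion p∈qs) (All.lookup (champion-max (prime>1 (ps-prime (qs⊆ps p∈qs)))) a∈)

      -- With at most k primes, a member outside the champions would be covered by them.
      bound-few-primes : length ps ≤ k → Unique (x ∷ xs) → length (x ∷ xs) ≤ length ps
      bound-few-primes ps≤k u = ≮⇒≥ λ ps<xs →
        let a , a∈ , a∉C = longer⇒∉ _≟_ u (subst (_< length (x ∷ xs)) (sym (length-map champion ps)) ps<xs)
        in uncoverable-T (champions ps) (All.lookup T-xs a∈) (champions-⊆A ps) a∉C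
             (subst (_≤ k) (sym (length-map champion ps)) ps≤k)
             (λ p∈ → champions-cover (λ q∈ → q∈) p∈ a∈)

      -- With k + 1 primes, a member a outside the champions is p-dominated by another
      -- member b for at most one prime p: b and the champions of the other k - 1 primes
      -- would cover a.
      dominated-once : length ps ≡ k + 1 → ∀ {a b i j} → a ∈ x ∷ xs → b ∈ x ∷ xs → a ∉ champions ps →
                       a ≢ b → i ∈ ps → j ∈ ps → i ≢ j → a ≼[ i ] b → a ≼[ j ] b → ⊥
      dominated-once ps≡k+1 {a} {b} {i} {j} a∈ b∈ a∉C a≢b i∈ j∈ i≢j a≼ᵢb a≼ⱼb
        with rest , ps↭ ← ∈⇒↭₂ i∈ j∈ i≢j =
        uncoverable-T (b ∷ champions rest) (All.lookup T-xs a∈)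
          (T⊆A b (All.lookup T-xs b∈) ∷ champions-⊆A rest) a∉L L≤k covers
        where
        rest⊆ps : ∀ {q} → q ∈ rest → q ∈ ps
        rest⊆ps q∈ = ∈-resp-↭ (↭-sym ps↭) (there (there q∈))
        a∉L : a ∉ b ∷ champions rest
        a∉L (here a≡b) = a≢b a≡b
        a∉L (there a∈Cr) with q , q∈ , refl ← ∈-map⁻ champion a∈Cr = a∉C (∈-map⁺ champion (rest⊆ps q∈))
        L≤k : length (b ∷ champions rest) ≤ k
        L≤k = ≤-reflexive (suc-injective (begin
          suc (suc (length (champions rest))) ≡⟨ cong (suc ∘ suc) (length-map champion rest) ⟩
          length (i ∷ j ∷ rest)               ≡⟨ sym (↭-length ps↭) ⟩
          length ps                           ≡⟨ ps≡k+1 ⟩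
          k + 1                               ≡⟨ +-comm k 1 ⟩
          suc k                               ∎))
          where open ≡-Reasoning
        covers : ∀ {p} → p ∈ ps → Any (a ≼[ p ]_) (b ∷ champions rest)
        covers p∈ with ∈-resp-↭ ps↭ p∈
        ... | here refl = here a≼ᵢb
        ... | there (here refl) = here a≼ⱼb
        ... | there (there p∈rest) = there (champions-cover rest⊆ps p∈rest a∈)

      -- With k + 1 ≥ 3 primes, at most one member lies outside the champions, since
      -- two such members would be comparable at three primes in only two directions.
      bound-one-more-prime : 2 ≤ k → length ps ≡ k + 1 → Unique ps → Unique (x ∷ xs) →
                             length (x ∷ xs) ≤ suc (length ps)
      bound-one-more-prime 2≤k ps≡k+1 u-ps u = ≮⇒≥ λ long →
        let a , a∈ , a∉C = longer⇒∉ _≟_ u (subst (_< _) (sym (length-map champion ps)) (<⇒≤ long))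
            b , b∈ , b∉a∷C = longer⇒∉ _≟_ u (subst (λ n → suc n < _) (sym (length-map champion ps)) long)
            a≢b = λ a≡b → b∉a∷C (here (sym a≡b))
        in <⇒≱ (subst (2 <_) (sym ps≡k+1) (≤-trans (s≤s 2≤k) (≤-reflexive (+-comm 1 k))))
             (two-colours u-ps (λ p∈ → ≼-compare (prime>1 (ps-prime p∈)) a b)
               (dominated-once ps≡k+1 a∈ b∈ a∉C a≢b)
               (dominated-once ps≡k+1 b∈ a∈ (b∉a∷C ∘ there) (a≢b ∘ sym)))

    -- The case of k = 2 and four primes p₁, …, p₄: each member a of a list xs in T gets a
    -- Boolean function of three variables recording for which sets of exempted primes
    -- among p₁, p₂, p₃ another member dominates a at p₄ and at the other primes.
    module FourPrimes (k≡2 : k ≡ 2) {p₁ p₂ p₃ p₄} (ps≡ : ps ≡ p₁ ∷ p₂ ∷ p₃ ∷ p₄ ∷ [])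
                      {xs} (T-xs : All T xs) where

      four-primes>1 : ∀ {p} → p ∈ p₁ ∷ p₂ ∷ p₃ ∷ p₄ ∷ [] → 1 < p
      four-primes>1 p∈ = prime>1 (ps-prime (subst (_ ∈_) (sym ps≡) p∈))

      cover-at-four : ∀ {a L} → Any (a ≼[ p₁ ]_) L → Any (a ≼[ p₂ ]_) L → Any (a ≼[ p₃ ]_) L →
                      Any (a ≼[ p₄ ]_) L → ∀ {p} → p ∈ ps → Any (a ≼[ p ]_) L
      cover-at-four h₁ h₂ h₃ h₄ p∈ with subst (_ ∈_) ps≡ p∈
      ... | here refl = h₁
      ... | there (here refl) = h₂
      ... | there (there (here refl)) = h₃
      ... | there (there (there (here refl))) = h₄

      _≼?[_]_ : ∀ a {p} → p ∈ p₁ ∷ p₂ ∷ p₃ ∷ p₄ ∷ [] → ∀ c → Dec (a ≼[ p ] c)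
      a ≼?[ p∈ ] c = ≼-dec (four-primes>1 p∈) a c

      Needs : Bool → Set → Set
      Needs true _ = ⊤
      Needs false P = P

      needs? : ∀ s {P} → Dec P → Dec (Needs s P)
      needs? true _ = yes tt
      needs? false P? = P?

      Witness : ℕ → Bool → Bool → Bool → ℕ → Set
      Witness a s₁ s₂ s₃ c =
        a ≢ c × a ≼[ p₄ ] c × Needs s₁ (a ≼[ p₁ ] c) × Needs s₂ (a ≼[ p₂ ] c) × Needs s₃ (a ≼[ p₃ ] c)

      witness? : ∀ a s₁ s₂ s₃ c → Dec (Witness a s₁ s₂ s₃ c)
      witness? a s₁ s₂ s₃ c =
        ¬? (a ≟ c) ×-dec a ≼?[ there (there (there (here refl))) ] c ×-dec
        needs? s₁ (a ≼?[ here refl ] c) ×-dec needs? s₂ (a ≼?[ there (here refl) ] c) ×-dec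
        needs? s₃ (a ≼?[ there (there (here refl)) ] c)

      profile : ℕ → Fun₃
      profile a s₁ s₂ s₃ = does (any? (witness? a s₁ s₂ s₃) xs)

      code : ℕ → Table
      code a = table (profile a)

      -- Exempting more primes only makes witnessing easier.
      profile-monotone : ∀ a → Monotone (profile a)
      profile-monotone a s₁ s₂ s₃ =
        relax (λ (a≢c , d₄ , _ , d₂ , d₃) → a≢c , d₄ , tt , d₂ , d₃) ,
        relax (λ (a≢c , d₄ , d₁ , _ , d₃) → a≢c , d₄ , d₁ , tt , d₃) ,
        relax (λ (a≢c , d₄ , d₁ , d₂ , _) → a≢c , d₄ , d₁ , d₂ , tt)
        where
        relax : ∀ {s₁ s₂ s₃ t₁ t₂ t₃} → (∀ {c} → Witness a s₁ s₂ s₃ c → Witness a t₁ t₂ t₃ c) →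
                profile a s₁ s₂ s₃ ≤ᵇ profile a t₁ t₂ t₃
        relax {s₁} {s₂} {s₃} {t₁} {t₂} {t₃} w =
          does-mono (any? (witness? a s₁ s₂ s₃) xs) (any? (witness? a t₁ t₂ t₃) xs) (Any.map w)

      -- Without exemptions a witness would cover a on its own.
      profile-bottom : ∀ {a} → a ∈ xs → profile a false false false ≡ false
      profile-bottom {a} a∈ = dec-false (any? (witness? a false false false) xs) λ some →
        let c , c∈ , a≢c , d₄ , d₁ , d₂ , d₃ = find some
        in uncoverable-T (c ∷ []) (All.lookup T-xs a∈) (T⊆A c (All.lookup T-xs c∈) ∷ [])
             (λ { (here a≡c) → a≢c a≡c }) (subst (1 ≤_) (sym k≡2) (s≤s z≤n))
             (cover-at-four (here d₁) (here d₂) (here d₃) (here d₄))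

      code-admissible : ∀ {a} → a ∈ xs → Admissible (code a)
      code-admissible {a} a∈ = admissible-table {profile a} (profile-bottom a∈) (profile-monotone a)

      exempt : ∀ {P : Set} → Dec P → Bool
      exempt P? = not (does P?)

      needs-exempt : ∀ {P : Set} (P? : Dec P) → Needs (exempt P?) P
      needs-exempt (yes p) = p
      needs-exempt (no _) = tt

      exempt⇒¬ : ∀ {P Q : Set} (P? : Dec P) → Needs (exempt P?) Q → Q ⊎ ¬ P
      exempt⇒¬ (yes _) q = inj₁ q
      exempt⇒¬ (no ¬p) _ = inj₂ ¬p

      pattern-of : ℕ → ℕ → Fun₃ → Bool
      pattern-of a b f = f (exempt (a ≼?[ here refl ] b)) (exempt (a ≼?[ there (here refl) ] b))
                           (exempt (a ≼?[ there (there (here refl)) ] b))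

      -- If a ≼[ p₄ ] b, then b witnesses for a the pattern of a against b ...
      witnessed : ∀ {a b} → b ∈ xs → a ≢ b → a ≼[ p₄ ] b → pattern-of a b (profile a) ≡ true
      witnessed {a} {b} b∈ a≢b a≼₄b = dec-true (any? (witness? a _ _ _) xs)
        (lose b∈ (a≢b , a≼₄b , needs-exempt (a ≼?[ here refl ] b) , needs-exempt (a ≼?[ there (here refl) ] b) ,
                  needs-exempt (a ≼?[ there (there (here refl)) ] b)))

      -- ... while a witness c of it for b would make a and c cover b.
      unwitnessed : ∀ {a b} → a ∈ xs → b ∈ xs → a ≢ b → pattern-of a b (profile b) ≡ false
      unwitnessed {a} {b} a∈ b∈ a≢b = dec-false (any? (witness? b _ _ _) xs) λ some →
        let c , c∈ , b≢c , b≼₄c , n₁ , n₂ , n₃ = find some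
        in uncoverable-T (a ∷ c ∷ []) (All.lookup T-xs b∈)
             (T⊆A a (All.lookup T-xs a∈) ∷ T⊆A c (All.lookup T-xs c∈) ∷ [])
             (λ { (here b≡a) → a≢b (sym b≡a) ; (there (here b≡c)) → b≢c b≡c })
             (≤-reflexive (sym k≡2))
             (cover-at-four (cover-b (a ≼?[ here refl ] b) n₁) (cover-b (a ≼?[ there (here refl) ] b) n₂)
                            (cover-b (a ≼?[ there (there (here refl)) ] b) n₃) (there (here b≼₄c)))
        where
        cover-b : ∀ {p c} → (d : Dec (a ≼[ p ] b)) → Needs (exempt d) (b ≼[ p ] c) → Any (b ≼[ p ]_) (a ∷ c ∷ [])
        cover-b d n with exempt⇒¬ d n
        ... | inj₁ b≼c = there (here b≼c)
        ... | inj₂ a⋠b = here (≼-total a⋠b)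

      separation : ∀ {a b} → a ∈ xs → b ∈ xs → a ≢ b → a ≼[ p₄ ] b → code a ≢ code b
      separation {a} {b} a∈ b∈ a≢b a≼₄b code≡ = true≢false (begin
        true                           ≡⟨ sym (witnessed b∈ a≢b a≼₄b) ⟩
        pattern-of a b (profile a)     ≡⟨ sym (entry-table (profile a) _ _ _) ⟩
        pattern-of a b (entry (code a)) ≡⟨ cong (λ t → pattern-of a b (entry t)) code≡ ⟩
        pattern-of a b (entry (code b)) ≡⟨ entry-table (profile b) _ _ _ ⟩
        pattern-of a b (profile b)     ≡⟨ unwitnessed a∈ b∈ a≢b ⟩
        false                          ∎)
        where
        open ≡-Reasoning
        true≢false : true ≢ false
        true≢false ()

      -- Distinct members have distinct codes: one dominates the other at p₄.
      code-injective : ∀ {a b} → a ∈ xs → b ∈ xs → a ≢ b → code a ≢ code b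
      code-injective {a} {b} a∈ b∈ a≢b with ≼-compare (four-primes>1 (there (there (there (here refl))))) a b
      ... | inj₁ a≼b = separation a∈ b∈ a≢b a≼b
      ... | inj₂ b≼a = separation b∈ a∈ (a≢b ∘ sym) b≼a ∘ sym

      bound-four-primes : Unique xs → length xs ≤ 19
      bound-four-primes u = begin
        length xs                           ≡⟨ sym (length-map code xs) ⟩
        length (map code xs)                ≤⟨ unique-⊆⇒length≤ codes-unique codes-admissible ⟩
        length (filter admissible? tables)  ≡⟨ admissible-count ⟩
        19                                  ∎
        where
        open ≤-Reasoning
        codes-admissible : ∀ {t} → t ∈ map code xs → t ∈ filter admissible? tables
        codes-admissible t∈ with a , a∈ , refl ← ∈-map⁻ code t∈ =
          ∈-filter⁺ admissible? (∈-tables _) (code-admissible a∈)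
        codes-unique : Unique (map code xs)
        codes-unique = map-unique code code-injective (All.tabulate λ a∈ → a∈) u

    bound-few : length ps ≤ k → CardLe T (length ps)
    bound-few ps≤k [] _ _ = z≤n
    bound-few ps≤k (x ∷ xs) u T-xs = Champions.bound-few-primes T-xs ps≤k u

    bound-one-more : 2 ≤ k → length ps ≡ k + 1 → Unique ps → CardLe T (length ps + 1)
    bound-one-more 2≤k ps≡k+1 u-ps [] _ _ = z≤n
    bound-one-more 2≤k ps≡k+1 u-ps (x ∷ xs) u T-xs =
      subst (length (x ∷ xs) ≤_) (+-comm 1 (length ps)) (Champions.bound-one-more-prime T-xs 2≤k ps≡k+1 u-ps u)

    bound-four : k ≡ 2 → length ps ≡ 4 → CardLe T 19
    bound-four k≡2 ps≡4 xs u T-xs with p₁ , p₂ , p₃ , p₄ , ps≡ ← four-members ps ps≡4 =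
      FourPrimes.bound-four-primes k≡2 ps≡ T-xs u

lemma2p2 : (k : ℕ) → 2 ≤ k → (A : NatSet) → KPrimitive k A →
    (T : NatSet) → T ⊆ A → (n : ℕ) → HasCard (PrimesOf T) n →
    (n ≤ k → CardLe T n) ×
    (n ≡ k + 1 → CardLe T (n + 1)) ×
    (k ≡ 2 → n ≡ 4 → CardLe T 19)
lemma2p2 k 2≤k A prim T T⊆A .(length ps) (ps , u-ps , refl , ps-primes) =
  bound-few , (λ ps≡k+1 → bound-one-more 2≤k ps≡k+1 u-ps) , bound-four
  where open Primitive.OverT prim T⊆A ps-primes
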